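{- Let $G$ be a path, a cycle, or a wheel (a cycle $C$ together with one extra vertex joined by an edge to every vertex of $C$), and let $u,v\in V(G)$. Form the bunkbed graph $\tilde G$ and let $S\subseteq V(\tilde G)$ be chosen uniformly at random among all subsets of $V(\tilde G)$. Then the probability that there is a path in $\tilde G$ from $u^{(0)}$ to $v^{(0)}$ all of whose vertices lie in $S$ is at least the probability that there is a path in $\tilde G$ from $u^{(0)}$ to $v^{(1)}$ all of whose vertices lie in $S$.
   Context: For a finite simple graph $G$, the bunkbed graph $\tilde G$ consists of two copies $G_0,G_1$ of $G$, with $v^{(i)}$ denoting the copy of $v\in V(G)$ in $G_i$, together with an edge $v^{(0)}v^{(1)}$ for each $v\in V(G)$. -}

module Defs where

open import Data.Nat using (ℕ; zero; suc; _≤_)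
open import Data.Fin using (Fin; toℕ) renaming (zero to fz; suc to fs)
open import Data.Bool using (Bool; true; false)
open import Data.Vec using (Vec; []; _∷_; lookup)
open import Data.List using (List; []; _∷_; map; concatMap; filter; length)
open import Data.Product using (_×_; _,_)
open import Data.Sum using (_⊎_)
open import Data.Empty using (⊥)
open import Data.Unit using (⊤)
open import Relation.Nullary using (¬_; Dec)
open import Relation.Unary using (Decidable)
open import Relation.Binary.PropositionalEquality using (_≡_)

record Graph : Set₁ where
  field
    n   : ℕ
    Adj : Fin n → Fin n → Set
open Graph public

PathAdj : (n : ℕ) → Fin n → Fin n → Set
PathAdj n i j = (toℕ j ≡ suc (toℕ i)) ⊎ (toℕ i ≡ suc (toℕ j))

CycleAdj : (n : ℕ) → Fin n → Fin n → Set
CycleAdj n i j = PathAdj n i j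
               ⊎ ((toℕ i ≡ 0 × suc (toℕ j) ≡ n) ⊎ (toℕ j ≡ 0 × suc (toℕ i) ≡ n))

WheelAdj : (n : ℕ) → Fin (suc n) → Fin (suc n) → Set
WheelAdj n fz     fz     = ⊥
WheelAdj n fz     (fs _) = ⊤
WheelAdj n (fs _) fz     = ⊤
WheelAdj n (fs i) (fs j) = CycleAdj n i j

pathGraph : ℕ → Graph
pathGraph n = record { n = n ; Adj = PathAdj n }

cycleGraph : ℕ → Graph
cycleGraph n = record { n = n ; Adj = CycleAdj n }

wheelGraph : ℕ → Graph
wheelGraph n = record { n = suc n ; Adj = WheelAdj n }

data PathCycleOrWheel : Graph → Set₁ where
  isPath  : (n : ℕ) → PathCycleOrWheel (pathGraph n)
  isCycle : (n : ℕ) → 3 ≤ n → PathCycleOrWheel (cycleGraph n)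
  isWheel : (n : ℕ) → 3 ≤ n → PathCycleOrWheel (wheelGraph n)

-- Vertices of the bunkbed graph: (v , false) = v⁽⁰⁾, (v , true) = v⁽¹⁾.
BVertex : Graph → Set
BVertex G = Fin (n G) × Bool

BAdj : (G : Graph) → BVertex G → BVertex G → Set
BAdj G (x , b) (y , c) = (b ≡ c × Adj G x y) ⊎ (x ≡ y × ¬ (b ≡ c))

-- A subset S of V(G̃): the pair (S₀ , S₁) of characteristic vectors of
-- S ∩ V(G₀) and S ∩ V(G₁).
BSubset : Graph → Set
BSubset G = Vec Bool (n G) × Vec Bool (n G)

InS : (G : Graph) → BVertex G → BSubset G → Set
InS G (x , false) (S₀ , S₁) = lookup S₀ x ≡ true
InS G (x , true)  (S₀ , S₁) = lookup S₁ x ≡ true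

data Conn (G : Graph) (S : BSubset G) : BVertex G → BVertex G → Set where
  here : ∀ {x} → InS G x S → Conn G S x x
  step : ∀ {x y z} → InS G x S → BAdj G x y → Conn G S y z → Conn G S x z

allVecs : (m : ℕ) → List (Vec Bool m)
allVecs zero    = [] ∷ []
allVecs (suc m) = concatMap (λ v → (false ∷ v) ∷ (true ∷ v) ∷ []) (allVecs m)

allBSubsets : (G : Graph) → List (BSubset G)
allBSubsets G = concatMap (λ s₀ → map (λ s₁ → (s₀ , s₁)) (allVecs (n G))) (allVecs (n G))

countSubsets : (G : Graph) {P : BSubset G → Set} → Decidable P → ℕ
countSubsets G d = length (filter d (allBSubsets G))

-- A set S in which u⁰ reaches v¹ but not v⁰ is sent to one in which u⁰ reaches v⁰ but not v¹ by
-- exchanging the two layers at the vertices of a set R ∋ v (so v¹ disappears, as v⁰ ∉ S); sets in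
-- which u⁰ reaches v⁰ are kept, and the result is an injection. A walk in S maps to a walk in the
-- swapped set as long as each of its edges has both ends on the same side of R or an end x that is
-- symmetric: S contains both or none of x⁰, x¹. Swaps preserve symmetry, so choosing R from the
-- symmetric vertices alone makes the map an involution. On a cycle (a path is part of one) R is
-- everything but u if u is symmetric, and otherwise an arc around v bounded by symmetric vertices;
-- if one side of v has none, the arc extends to u, and a walk cannot exploit the unprotected
-- boundary at u because it cannot change layers on that side. On a wheel containing the hub, R is
-- everything but u if u is symmetric, otherwise {v} when that lets u⁰ reach v⁰ (always so when
-- hub⁰ ∈ S) and everything but u again if not; the inverse tells these apart since swapping v alone
-- afterwards leaves u⁰ unable to reach v¹. Without the hub, the rim argument applies.

module Submission where

open import Defs
open import Data.Nat using (ℕ; zero; suc; _≤_; _<_; z≤n; s≤s; z<s; _+_; _∸_; _<ᵇ_)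
open import Data.Nat.Properties
  using ( _≤?_; _<?_; <-cmp; ≤-refl; ≤-reflexive; ≤-antisym; ≤-trans; <-trans; ≤-<-trans; <-≤-trans
        ; ≤-pred; <⇒≤; <⇒≱; <⇒≢; ≰⇒>; ≮⇒≥; ≤∧≢⇒<; n<1+n; m≤n⇒m≤1+n; n≤0⇒n≡0; n≢0⇒n>0; m≤n+m
        ; +-monoˡ-<; +-cancelʳ-≡; n∸n≡0; m∸n≤m; m+n∸m≡n; m+n∸n≡m; m+[n∸m]≡n; m∸[m∸n]≡n; m≤n⇒m∸n≡0
        ; m<n⇒0<n∸m; +-∸-assoc; ∸-monoˡ-<; ∸-monoʳ-<; ∸-monoʳ-≤; ∸-cancelʳ-≡ )
open import Data.Fin using (Fin; toℕ) renaming (zero to fz; suc to fs)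
import Data.Fin.Properties as Fin
open import Data.Bool using (Bool; true; false; not; _xor_; _∨_; _∧_; if_then_else_)
import Data.Bool.Properties as Bool
open import Data.Vec using (Vec; []; _∷_; tail; lookup; tabulate)
open import Data.Vec.Properties using (lookup∘tabulate; tabulate∘lookup; tabulate-cong)
open import Data.List using (List; []; _∷_; map; concatMap; filter; length; _++_)
open import Data.List.Properties using (length-map; length-++-sucʳ; map-∘; map-id-local)
open import Data.List.Membership.Propositional using (_∈_)
open import Data.List.Membership.Propositional.Properties
  using (∈-∃++; ∈-++⁻; ∈-++⁺ˡ; ∈-++⁺ʳ; ∈-concatMap⁺; ∈-map⁺; ∈-map⁻; ∈-filter⁺)
open import Data.List.Relation.Binary.Disjoint.Propositional using (Disjoint)
open import Data.List.Relation.Unary.Any using (here; there)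
import Data.List.Relation.Unary.Any as Any
import Data.List.Relation.Unary.All as All
import Data.List.Relation.Unary.All.Properties as Allₚ
import Data.List.Relation.Unary.AllPairs as AllPairs
import Data.List.Relation.Unary.AllPairs.Properties as AllPairs
open import Data.List.Relation.Unary.Unique.Propositional using (Unique; []; _∷_)
import Data.List.Relation.Unary.Unique.Propositional.Properties as Unique
open import Data.Product using (_×_; _,_; proj₁; proj₂; ∃)
open import Data.Sum using (_⊎_; inj₁; inj₂)
import Data.Sum as Sum
open import Data.Unit using (tt)
open import Data.Empty using (⊥; ⊥-elim)
open import Function using (_∘_; id)
open import Relation.Nullary using (¬_; Dec; yes; no; does; contradiction)
open import Relation.Nullary.Decidable using (dec-true; dec-false; _×-dec_; toSum)
open import Relation.Unary using (Decidable)
open import Relation.Binary using (tri<; tri≈; tri>)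
open import Relation.Binary.PropositionalEquality
  using (_≡_; _≢_; refl; sym; trans; cong; cong₂; subst; module ≡-Reasoning)


-- Counting subsets

length-≤-of-Unique-⊆ : ∀ {A : Set} {xs ys : List A} → Unique xs → (∀ {x} → x ∈ xs → x ∈ ys)
  → length xs ≤ length ys
length-≤-of-Unique-⊆ {xs = []} _ _ = z≤n
length-≤-of-Unique-⊆ {xs = x ∷ xs} (x∉xs ∷ !xs) xs⊆ys with ∈-∃++ (xs⊆ys (here refl))
... | ys₁ , ys₂ , refl = subst (suc (length xs) ≤_) (sym (length-++-sucʳ ys₁ x ys₂))
      (s≤s (length-≤-of-Unique-⊆ !xs xs⊆ys₁++ys₂))
  where
  xs⊆ys₁++ys₂ : ∀ {y} → y ∈ xs → y ∈ ys₁ ++ ys₂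
  xs⊆ys₁++ys₂ {y} y∈xs with ∈-++⁻ ys₁ (xs⊆ys (there y∈xs))
  ... | inj₁ y∈ys₁         = ∈-++⁺ˡ y∈ys₁
  ... | inj₂ (here y≡x)    = contradiction (sym y≡x) (All.lookup x∉xs y∈xs)
  ... | inj₂ (there y∈ys₂) = ∈-++⁺ʳ ys₁ y∈ys₂

Unique-concatMap : ∀ {A B : Set} (f : A → List B) {xs : List A} → Unique xs → (∀ x → Unique (f x))
  → (∀ {x y b} → b ∈ f x → b ∈ f y → x ≡ y) → Unique (concatMap f xs)
Unique-concatMap f {xs} !xs !f shared = Unique.concat⁺
  (Allₚ.map⁺ (All.universal !f xs))
  (AllPairs.map⁺ (AllPairs.map disjoint !xs))
  where
  disjoint : ∀ {x y} → x ≢ y → Disjoint (f x) (f y)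
  disjoint x≢y (b∈fx , b∈fy) = x≢y (shared b∈fx b∈fy)

allVecs-complete : ∀ m (s : Vec Bool m) → s ∈ allVecs m
allVecs-complete zero    []          = here refl
allVecs-complete (suc m) (false ∷ s) =
  ∈-concatMap⁺ _ (Any.map (λ { refl → here refl }) (allVecs-complete m s))
allVecs-complete (suc m) (true ∷ s)  =
  ∈-concatMap⁺ _ (Any.map (λ { refl → there (here refl) }) (allVecs-complete m s))

allVecs-unique : ∀ m → Unique (allVecs m)
allVecs-unique zero    = All.[] ∷ []
allVecs-unique (suc m) =
  Unique-concatMap _ (allVecs-unique m) (λ _ → ((λ ()) All.∷ All.[]) ∷ All.[] ∷ [])
    (λ p q → trans (sym (tail≡ p)) (tail≡ q))
  where
  tail≡ : ∀ {s : Vec Bool m} {t} → t ∈ (false ∷ s) ∷ (true ∷ s) ∷ [] → tail t ≡ s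
  tail≡ (here refl)         = refl
  tail≡ (there (here refl)) = refl

allBSubsets-complete : (G : Graph) (S : BSubset G) → S ∈ allBSubsets G
allBSubsets-complete G (S₀ , S₁) = ∈-concatMap⁺ _
  (Any.map (λ { refl → ∈-map⁺ (S₀ ,_) (allVecs-complete (n G) S₁) }) (allVecs-complete (n G) S₀))

allBSubsets-unique : (G : Graph) → Unique (allBSubsets G)
allBSubsets-unique G = Unique-concatMap _ (allVecs-unique (n G))
  (λ _ → Unique.map⁺ (cong proj₂) (allVecs-unique (n G))) (λ p q → trans (sym (proj₁≡ p)) (proj₁≡ q))
  where
  proj₁≡ : ∀ {S₀ S} → S ∈ map (S₀ ,_) (allVecs (n G)) → proj₁ S ≡ S₀
  proj₁≡ S∈ with ∈-map⁻ _ S∈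
  ... | _ , _ , refl = refl

countSubsets-≤-of-retraction : (G : Graph) {P Q : BSubset G → Set} (P? : Decidable P) (Q? : Decidable Q)
  (f g : BSubset G → BSubset G) → (∀ S → P S → Q (f S)) → (∀ S → P S → g (f S) ≡ S)
  → countSubsets G P? ≤ countSubsets G Q?
countSubsets-≤-of-retraction G P? Q? f g f-maps g∘f≡id =
  subst (_≤ countSubsets G Q?) (length-map f Ps) (length-≤-of-Unique-⊆ !fPs fPs⊆Qs)
  where
  Ps = filter P? (allBSubsets G)
  allP : All.All _ Ps
  allP = Allₚ.all-filter P? (allBSubsets G)
  !fPs : Unique (map f Ps)
  !fPs = Unique.map⁻ {f = g} (subst Unique (trans (sym (map-id-local (All.map (g∘f≡id _) allP))) (map-∘ Ps))
                                   (Unique.filter⁺ P? (allBSubsets-unique G)))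
  fPs⊆Qs : ∀ {T} → T ∈ map f Ps → T ∈ filter Q? (allBSubsets G)
  fPs⊆Qs T∈ with ∈-map⁻ f T∈
  ... | S , S∈Ps , refl = ∈-filter⁺ Q? (allBSubsets-complete G (f S)) (f-maps S (All.lookup allP S∈Ps))

-- Swapping the two layers

xor-cancelʳ : ∀ c r → (c xor r) xor r ≡ c
xor-cancelʳ false false = refl
xor-cancelʳ false true  = refl
xor-cancelʳ true  false = refl
xor-cancelʳ true  true  = refl

xor-injectiveˡ : ∀ r {b c} → b xor r ≡ c xor r → b ≡ c
xor-injectiveˡ r {b} {c} e = trans (sym (xor-cancelʳ b r)) (trans (cong (_xor r) e) (xor-cancelʳ c r))

xor-injectiveʳ : ∀ b {r r′} → b xor r ≡ b xor r′ → r ≡ r′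
xor-injectiveʳ false e = e
xor-injectiveʳ true  e = Bool.not-injective e

xor-flip : ∀ b {r r′} → r ≢ r′ → (b xor r′) xor r ≡ not b
xor-flip b     {false} {false} r≢r′ = contradiction refl r≢r′
xor-flip false {false} {true}  _    = refl
xor-flip true  {false} {true}  _    = refl
xor-flip false {true}  {false} _    = refl
xor-flip true  {true}  {false} _    = refl
xor-flip b     {true}  {true}  r≢r′ = contradiction refl r≢r′

xor-true : ∀ c → c xor true ≡ not c
xor-true false = refl
xor-true true  = refl

Layers : ℕ → Set
Layers k = Vec Bool k × Vec Bool k

mem : ∀ {k} → Layers k → Fin k → Bool → Bool
mem (S₀ , S₁) x false = lookup S₀ x
mem (S₀ , S₁) x true  = lookup S₁ x

InS⇒mem : ∀ {G : Graph} {S : BSubset G} {x} b → InS G (x , b) S → mem S x b ≡ true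
InS⇒mem false p = p
InS⇒mem true  p = p

mem⇒InS : ∀ {G : Graph} {S : BSubset G} {x} b → mem S x b ≡ true → InS G (x , b) S
mem⇒InS false p = p
mem⇒InS true  p = p

mem-extensional : ∀ {k} {S T : Layers k} → (∀ x c → mem S x c ≡ mem T x c) → S ≡ T
mem-extensional S≗T = cong₂ _,_ (layer≡ (λ x → S≗T x false)) (layer≡ (λ x → S≗T x true))
  where
  layer≡ : ∀ {k} {U V : Vec Bool k} → (∀ x → lookup U x ≡ lookup V x) → U ≡ V
  layer≡ {U = U} {V} U≗V = trans (sym (tabulate∘lookup U)) (trans (tabulate-cong U≗V) (tabulate∘lookup V))

swapLayers : ∀ {k} → (Fin k → Bool) → Layers k → Layers k
swapLayers R S = tabulate (λ x → mem S x (R x)) , tabulate (λ x → mem S x (not (R x)))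

mem-swapLayers : ∀ {k} R (S : Layers k) x c → mem (swapLayers R S) x c ≡ mem S x (c xor R x)
mem-swapLayers R S x false = lookup∘tabulate _ x
mem-swapLayers R S x true  = lookup∘tabulate _ x

mem-swapLayers-fixed : ∀ {k} R (S : Layers k) x c → R x ≡ false → mem (swapLayers R S) x c ≡ mem S x c
mem-swapLayers-fixed R S x c Rx rewrite mem-swapLayers R S x c | Rx = cong (mem S x) (Bool.xor-identityʳ c)

mem-swapLayers-moved : ∀ {k} R (S : Layers k) x c → R x ≡ true → mem (swapLayers R S) x c ≡ mem S x (not c)
mem-swapLayers-moved R S x c Rx rewrite mem-swapLayers R S x c | Rx = cong (mem S x) (xor-true c)

swapLayers-involutive : ∀ {k} R (S : Layers k) → swapLayers R (swapLayers R S) ≡ S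
swapLayers-involutive R S = mem-extensional λ x c → begin
  mem (swapLayers R (swapLayers R S)) x c ≡⟨ mem-swapLayers R (swapLayers R S) x c ⟩
  mem (swapLayers R S) x (c xor R x)      ≡⟨ mem-swapLayers R S x (c xor R x) ⟩
  mem S x ((c xor R x) xor R x)           ≡⟨ cong (mem S x) (xor-cancelʳ c (R x)) ⟩
  mem S x c                               ∎
  where open ≡-Reasoning

swapLayers-comm : ∀ {k} R R′ (S : Layers k)
  → swapLayers R (swapLayers R′ S) ≡ swapLayers R′ (swapLayers R S)
swapLayers-comm R R′ S = mem-extensional λ x c → begin
  mem (swapLayers R (swapLayers R′ S)) x c ≡⟨ mem-swapLayers R (swapLayers R′ S) x c ⟩
  mem (swapLayers R′ S) x (c xor R x)      ≡⟨ mem-swapLayers R′ S x (c xor R x) ⟩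
  mem S x ((c xor R x) xor R′ x)           ≡⟨ cong (mem S x) (xor-swap c (R x) (R′ x)) ⟩
  mem S x ((c xor R′ x) xor R x)           ≡⟨ mem-swapLayers R S x (c xor R′ x) ⟨
  mem (swapLayers R S) x (c xor R′ x)      ≡⟨ mem-swapLayers R′ (swapLayers R S) x c ⟨
  mem (swapLayers R′ (swapLayers R S)) x c ∎
  where
  open ≡-Reasoning
  xor-swap : ∀ c r r′ → (c xor r) xor r′ ≡ (c xor r′) xor r
  xor-swap c r r′ =
    trans (Bool.xor-assoc c r r′) (trans (cong (c xor_) (Bool.xor-comm r r′)) (sym (Bool.xor-assoc c r′ r)))

occupied : ∀ {k} → Layers k → Fin k → Bool
occupied S x = mem S x false ∨ mem S x true

occupied-swapLayers : ∀ {k} R (S : Layers k) x → occupied (swapLayers R S) x ≡ occupied S x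
occupied-swapLayers R S x rewrite mem-swapLayers R S x false | mem-swapLayers R S x true with R x
... | false = refl
... | true  = Bool.∨-comm (mem S x true) (mem S x false)

unoccupied : ∀ {k} {S : Layers k} {x} b → occupied S x ≡ false → mem S x b ≡ false
unoccupied {S = S} {x} false e with mem S x false
... | false = refl
unoccupied {S = S} {x} true e with mem S x false | mem S x true
... | false | false = refl

Symmetric : ∀ {k} → Layers k → Fin k → Set
Symmetric S x = mem S x false ≡ mem S x true

Symmetric-other : ∀ {k} {S : Layers k} {x} b → Symmetric S x → mem S x b ≡ true → mem S x (not b) ≡ true
Symmetric-other false sym-x p = trans (sym sym-x) p
Symmetric-other true  sym-x p = trans sym-x p

asymmetry : ∀ {k} → Layers k → Fin k → Bool
asymmetry S x = mem S x false xor mem S x true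

-- A vector rather than a function, so that its invariance under swaps is an equation along which
-- a swap chosen from it can be rewritten.
asymmetries : ∀ {k} → Layers k → Vec Bool k
asymmetries S = tabulate (asymmetry S)

asymmetry-swapLayers : ∀ {k} R (S : Layers k) x → asymmetry (swapLayers R S) x ≡ asymmetry S x
asymmetry-swapLayers R S x rewrite mem-swapLayers R S x false | mem-swapLayers R S x true with R x
... | false = refl
... | true  = Bool.xor-comm (mem S x true) (mem S x false)

asymmetries-swapLayers : ∀ {k} R (S : Layers k) → asymmetries (swapLayers R S) ≡ asymmetries S
asymmetries-swapLayers R S = tabulate-cong (asymmetry-swapLayers R S)

Symmetric⇒asymmetries≡false : ∀ {k} (S : Layers k) x → Symmetric S x → lookup (asymmetries S) x ≡ false
Symmetric⇒asymmetries≡false S x sym-x = trans (lookup∘tabulate (asymmetry S) x)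
  (trans (cong (_xor mem S x true) sym-x) (Bool.xor-same (mem S x true)))

asymmetries≡false⇒Symmetric : ∀ {k} (S : Layers k) x → lookup (asymmetries S) x ≡ false → Symmetric S x
asymmetries≡false⇒Symmetric S x e =
  xor≡false⇒≡ (mem S x false) (mem S x true) (trans (sym (lookup∘tabulate (asymmetry S) x)) e)
  where
  xor≡false⇒≡ : ∀ a b → a xor b ≡ false → a ≡ b
  xor≡false⇒≡ false false _ = refl
  xor≡false⇒≡ true  true  _ = refl

asymmetries≡true⇒¬Symmetric : ∀ {k} (S : Layers k) x → lookup (asymmetries S) x ≡ true → ¬ Symmetric S x
asymmetries≡true⇒¬Symmetric S x e sym-x =
  contradiction (trans (sym e) (Symmetric⇒asymmetries≡false S x sym-x)) λ ()

swapByAsymmetries : ∀ {k} → (Vec Bool k → Fin k → Bool) → Layers k → Layers k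
swapByAsymmetries choice S = swapLayers (choice (asymmetries S)) S

swapByAsymmetries-involutive : ∀ {k} choice (S : Layers k)
  → swapByAsymmetries choice (swapByAsymmetries choice S) ≡ S
swapByAsymmetries-involutive choice S = begin
  swapLayers (choice (asymmetries (swapByAsymmetries choice S))) (swapByAsymmetries choice S)
    ≡⟨ cong (λ Y → swapLayers (choice Y) (swapByAsymmetries choice S))
            (asymmetries-swapLayers (choice (asymmetries S)) S) ⟩
  swapLayers (choice (asymmetries S)) (swapLayers (choice (asymmetries S)) S)
    ≡⟨ swapLayers-involutive (choice (asymmetries S)) S ⟩
  S ∎
  where open ≡-Reasoning

-- Walks through swaps

OnEdges : (G : Graph) → BSubset G → (BVertex G → BVertex G → Set) → Set
OnEdges G S P = ∀ {z z′} → InS G z S → BAdj G z z′ → InS G z′ S → P z z′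

module _ {G : Graph} {S : BSubset G} where

  Conn-head : ∀ {a b} → Conn G S a b → InS G a S
  Conn-head (here p)     = p
  Conn-head (step p _ _) = p

  Conn-last : ∀ {a b} → Conn G S a b → InS G b S
  Conn-last (here p)     = p
  Conn-last (step _ _ w) = Conn-last w

  Conn-trans : ∀ {a b c} → Conn G S a b → Conn G S b c → Conn G S a c
  Conn-trans (here _)     w′ = w′
  Conn-trans (step p e w) w′ = step p e (Conn-trans w w′)

  Conn-invariant : (I : BVertex G → Set) → OnEdges G S (λ z z′ → I z → I z′)
    → ∀ {a b} → Conn G S a b → I a → I b
  Conn-invariant I preserved (here _)     Ia = Ia
  Conn-invariant I preserved (step p e w) Ia = Conn-invariant I preserved w (preserved p e (Conn-head w) Ia)

  Conn-layers : ∀ {x y b b′ c c′} → b ≡ b′ → c ≡ c′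
    → Conn G S (x , b) (y , c) → Conn G S (x , b′) (y , c′)
  Conn-layers refl refl w = w

  horizontal : ∀ {x y} c → InS G (x , c) S → InS G (y , c) S → Adj G x y → Conn G S (x , c) (y , c)
  horizontal c p q xy = step p (inj₁ (refl , xy)) (here q)

  vertical : ∀ {x} c c′ → InS G (x , c) S → InS G (x , c′) S → c ≢ c′ → Conn G S (x , c) (x , c′)
  vertical c c′ p q c≢c′ = step p (inj₂ (refl , c≢c′)) (here q)

swapVertex : ∀ {k} → (Fin k → Bool) → Fin k × Bool → Fin k × Bool
swapVertex R (x , b) = x , b xor R x

Compatible : ∀ {k} → (Fin k → Bool) → Layers k → Fin k → Fin k → Set
Compatible R S x y = R x ≡ R y ⊎ Symmetric S x ⊎ Symmetric S y

module _ {G : Graph} (R : Fin (n G) → Bool) (S : BSubset G) where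

  private
    T = swapLayers R S

  InS-swapLayers : ∀ {x} c {b} → c xor R x ≡ b → mem S x b ≡ true → InS G (x , c) T
  InS-swapLayers {x} c refl p = mem⇒InS {G} {T} c (trans (mem-swapLayers R S x c) p)

  InS-swapVertex : ∀ {z} → InS G z S → InS G (swapVertex R z) T
  InS-swapVertex {x , b} p = InS-swapLayers (b xor R x) (xor-cancelʳ b (R x)) (InS⇒mem {G} {S} b p)

  -- Across the boundary of R the image of an edge is bridged by a vertical step at its symmetric end.
  swap-edge : OnEdges G S λ z z′
    → Compatible R S (proj₁ z) (proj₁ z′) → Conn G T (swapVertex R z) (swapVertex R z′)
  swap-edge {x , b} {.x , c} p (inj₂ (refl , b≢c)) q _ =
    vertical (b xor R x) (c xor R x) (InS-swapVertex p) (InS-swapVertex q) (b≢c ∘ xor-injectiveˡ (R x))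
  swap-edge {x , b} {y , .b} p (inj₁ (refl , xy)) q compatible with R x Bool.≟ R y
  ... | yes Rx≡Ry = subst (λ r → Conn G T (x , b xor R x) (y , b xor r)) Rx≡Ry
                      (horizontal (b xor R x) (InS-swapVertex p) q′ xy)
    where
    q′ : InS G (y , b xor R x) T
    q′ = InS-swapLayers (b xor R x) (trans (cong (λ r → (b xor r) xor R y) Rx≡Ry) (xor-cancelʳ b (R y)))
           (InS⇒mem {G} {S} b q)
  ... | no Rx≢Ry with compatible
  ...   | inj₁ Rx≡Ry = contradiction Rx≡Ry Rx≢Ry
  ...   | inj₂ (inj₁ sym-x) = Conn-trans
          (vertical (b xor R x) (b xor R y) (InS-swapVertex p) corner λ e → Rx≢Ry (xor-injectiveʳ b e))
          (horizontal (b xor R y) corner (InS-swapVertex q) xy)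
    where
    corner : InS G (x , b xor R y) T
    corner = InS-swapLayers (b xor R y) (xor-flip b Rx≢Ry) (Symmetric-other b sym-x (InS⇒mem {G} {S} b p))
  ...   | inj₂ (inj₂ sym-y) = Conn-trans
          (horizontal (b xor R x) (InS-swapVertex p) corner xy)
          (vertical (b xor R x) (b xor R y) corner (InS-swapVertex q) λ e → Rx≢Ry (xor-injectiveʳ b e))
    where
    corner : InS G (y , b xor R x) T
    corner = InS-swapLayers (b xor R x) (xor-flip b (Rx≢Ry ∘ sym)) (Symmetric-other b sym-y (InS⇒mem {G} {S} b q))

  swap-walk : OnEdges G S (λ z z′ → Compatible R S (proj₁ z) (proj₁ z′))
    → ∀ {a b} → Conn G S a b → Conn G T (swapVertex R a) (swapVertex R b)
  swap-walk compatible {a} w = Conn-invariant (λ z → Conn G T (swapVertex R a) (swapVertex R z))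
    (λ p e q acc → Conn-trans acc (swap-edge p e q (compatible p e q)))
    w (here (InS-swapVertex (Conn-head w)))

-- Positions on a cycle

CyclicNeighbours : ℕ → ℕ → ℕ → Set
CyclicNeighbours N a b = b ≡ suc a ⊎ a ≡ suc b ⊎ (a ≡ 0 × suc b ≡ N) ⊎ (b ≡ 0 × suc a ≡ N)

CyclicNeighbours-sym : ∀ {N a b} → CyclicNeighbours N a b → CyclicNeighbours N b a
CyclicNeighbours-sym (inj₁ e)               = inj₂ (inj₁ e)
CyclicNeighbours-sym (inj₂ (inj₁ e))        = inj₁ e
CyclicNeighbours-sym (inj₂ (inj₂ (inj₁ e))) = inj₂ (inj₂ (inj₂ e))
CyclicNeighbours-sym (inj₂ (inj₂ (inj₂ e))) = inj₂ (inj₂ (inj₁ e))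

<⇒<ᵇ≡true : ∀ {a b} → a < b → (a <ᵇ b) ≡ true
<⇒<ᵇ≡true {zero}  {suc b} _         = refl
<⇒<ᵇ≡true {suc a} {suc b} (s≤s a<b) = <⇒<ᵇ≡true a<b

≤⇒<ᵇ≡false : ∀ {a b} → b ≤ a → (a <ᵇ b) ≡ false
≤⇒<ᵇ≡false {a}     {zero}  _         = refl
≤⇒<ᵇ≡false {suc a} {suc b} (s≤s b≤a) = ≤⇒<ᵇ≡false b≤a

<ᵇ-stepʳ : ∀ lo k → (lo <ᵇ k) ≢ (lo <ᵇ suc k) → k ≡ lo
<ᵇ-stepʳ zero     zero    _  = refl
<ᵇ-stepʳ zero     (suc k) ne = contradiction refl ne
<ᵇ-stepʳ (suc lo) zero    ne = contradiction refl ne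
<ᵇ-stepʳ (suc lo) (suc k) ne = cong suc (<ᵇ-stepʳ lo k ne)

<ᵇ-stepˡ : ∀ k hi → (k <ᵇ hi) ≢ (suc k <ᵇ hi) → suc k ≡ hi
<ᵇ-stepˡ k       zero           ne = contradiction refl ne
<ᵇ-stepˡ zero    (suc zero)     _  = refl
<ᵇ-stepˡ zero    (suc (suc hi)) ne = contradiction refl ne
<ᵇ-stepˡ (suc k) (suc hi)       ne = cong suc (<ᵇ-stepˡ k hi ne)

between : ℕ → ℕ → ℕ → Bool
between lo hi k = (lo <ᵇ k) ∧ (k <ᵇ hi)

between-step : ∀ lo hi k → between lo hi k ≢ between lo hi (suc k) → k ≡ lo ⊎ suc k ≡ hi
between-step lo hi k ne with (lo <ᵇ k) Bool.≟ (lo <ᵇ suc k)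
... | no  lo-step = inj₁ (<ᵇ-stepʳ lo k lo-step)
... | yes lo-same = inj₂ (<ᵇ-stepˡ k hi λ hi-same → ne (cong₂ _∧_ lo-same hi-same))

module _ {N : ℕ} (u : Fin N) where
  private
    u<N = Fin.toℕ<n u
    u≤x+N : ∀ x → toℕ u ≤ x + N
    u≤x+N x = ≤-trans (<⇒≤ u<N) (m≤n+m N x)

    offsetℕ : ℕ → ℕ
    offsetℕ x with toℕ u ≤? x
    ... | yes _ = x ∸ toℕ u
    ... | no  _ = x + N ∸ toℕ u

    offsetℕ-self : offsetℕ (toℕ u) ≡ 0
    offsetℕ-self with toℕ u ≤? toℕ u
    ... | yes _   = n∸n≡0 (toℕ u)
    ... | no  u≰u = contradiction ≤-refl u≰u

    offsetℕ<N : ∀ x → x < N → offsetℕ x < N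
    offsetℕ<N x x<N with toℕ u ≤? x
    ... | yes _   = ≤-<-trans (m∸n≤m x (toℕ u)) x<N
    ... | no  u≰x = subst (x + N ∸ toℕ u <_) (m+n∸m≡n (toℕ u) N)
                      (∸-monoˡ-< (+-monoˡ-< N (≰⇒> u≰x)) (u≤x+N x))

    offsetℕ-injective : ∀ x y → x < N → y < N → offsetℕ x ≡ offsetℕ y → x ≡ y
    offsetℕ-injective x y x<N y<N e with toℕ u ≤? x | toℕ u ≤? y
    ... | yes u≤x | yes u≤y = ∸-cancelʳ-≡ u≤x u≤y e
    ... | no  _   | no  _   = +-cancelʳ-≡ N x y (∸-cancelʳ-≡ (u≤x+N x) (u≤x+N y) e)
    ... | yes u≤x | no  _   =
      contradiction (subst (N ≤_) (sym (∸-cancelʳ-≡ u≤x (u≤x+N y) e)) (m≤n+m N y)) (<⇒≱ x<N)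
    ... | no  _   | yes u≤y =
      contradiction (subst (N ≤_) (∸-cancelʳ-≡ (u≤x+N x) u≤y e) (m≤n+m N x)) (<⇒≱ y<N)

    offsetℕ-suc : ∀ x y → suc x ≡ y → CyclicNeighbours N (offsetℕ x) (offsetℕ y)
    offsetℕ-suc x .(suc x) refl with toℕ u ≤? x | toℕ u ≤? suc x
    ... | yes u≤x | yes _     = inj₁ (+-∸-assoc 1 u≤x)
    ... | yes u≤x | no  u≰1+x = contradiction (m≤n⇒m≤1+n u≤x) u≰1+x
    ... | no  _   | no  _     = inj₁ (+-∸-assoc 1 (u≤x+N x))
    ... | no  u≰x | yes u≤1+x = inj₂ (inj₂ (inj₂ (m≤n⇒m∸n≡0 (≤-reflexive 1+x≡u) ,
          trans (sym (+-∸-assoc 1 (u≤x+N x)))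
                (trans (cong (λ k → k + N ∸ toℕ u) 1+x≡u) (m+n∸m≡n (toℕ u) N)))))
      where
      1+x≡u : suc x ≡ toℕ u
      1+x≡u = ≤-antisym (≰⇒> u≰x) u≤1+x

    offsetℕ-wrap : ∀ x y → x ≡ 0 → suc y ≡ N → CyclicNeighbours N (offsetℕ x) (offsetℕ y)
    offsetℕ-wrap .0 y refl 1+y≡N with toℕ u ≤? 0 | toℕ u ≤? y
    ... | yes u≤0 | yes _   rewrite n≤0⇒n≡0 u≤0 = inj₂ (inj₂ (inj₁ (refl , 1+y≡N)))
    ... | yes u≤0 | no  u≰y = contradiction (≤-trans u≤0 z≤n) u≰y
    ... | no  _   | yes u≤y = inj₂ (inj₁ (trans (cong (_∸ toℕ u) (sym 1+y≡N)) (+-∸-assoc 1 u≤y)))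
    ... | no  _   | no  u≰y = contradiction (≤-pred (subst (toℕ u <_) (sym 1+y≡N) u<N)) u≰y

  offset : Fin N → ℕ
  offset x = offsetℕ (toℕ x)

  offset-self : offset u ≡ 0
  offset-self = offsetℕ-self

  offset<N : ∀ x → offset x < N
  offset<N x = offsetℕ<N (toℕ x) (Fin.toℕ<n x)

  offset-injective : ∀ {x y} → offset x ≡ offset y → x ≡ y
  offset-injective {x} {y} e =
    Fin.toℕ-injective (offsetℕ-injective (toℕ x) (toℕ y) (Fin.toℕ<n x) (Fin.toℕ<n y) e)

  offset-neighbours : ∀ {x y} → CycleAdj N x y → CyclicNeighbours N (offset x) (offset y)
  offset-neighbours (inj₁ (inj₁ y≡1+x))         = offsetℕ-suc _ _ (sym y≡1+x)
  offset-neighbours (inj₁ (inj₂ x≡1+y))         = CyclicNeighbours-sym (offsetℕ-suc _ _ (sym x≡1+y))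
  offset-neighbours (inj₂ (inj₁ (x≡0 , 1+y≡N))) = offsetℕ-wrap _ _ x≡0 1+y≡N
  offset-neighbours (inj₂ (inj₂ (y≡0 , 1+x≡N))) = CyclicNeighbours-sym (offsetℕ-wrap _ _ y≡0 1+x≡N)

-- Reflection of the cycle fixing 0; it is the identity beyond N, which keeps it injective.
module _ (N : ℕ) where
  mirror : ℕ → ℕ
  mirror zero    = zero
  mirror (suc k) = if suc k <ᵇ N then N ∸ suc k else suc k

  mirror-inside : ∀ {a} → 0 < a → a < N → mirror a ≡ N ∸ a
  mirror-inside {suc k} _ a<N rewrite <⇒<ᵇ≡true a<N = refl

  mirror-outside : ∀ {a} → N ≤ a → mirror a ≡ a
  mirror-outside {zero}  _   = refl
  mirror-outside {suc k} N≤a rewrite ≤⇒<ᵇ≡false N≤a = refl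

  mirror<N : ∀ {a} → a < N → mirror a < N
  mirror<N {zero}  a<N = a<N
  mirror<N {suc k} a<N rewrite mirror-inside z<s a<N = ∸-monoʳ-< z<s (<⇒≤ a<N)

  mirror<N⁻¹ : ∀ {a} → mirror a < N → a < N
  mirror<N⁻¹ {a} m<N with a <? N
  ... | yes a<N = a<N
  ... | no  a≮N = contradiction (subst (_< N) (mirror-outside (≮⇒≥ a≮N)) m<N) a≮N

  mirror-involutive : ∀ {a} → a < N → mirror (mirror a) ≡ a
  mirror-involutive {zero}  _   = refl
  mirror-involutive {suc k} a<N = begin
    mirror (mirror (suc k)) ≡⟨ cong mirror (mirror-inside z<s a<N) ⟩
    mirror (N ∸ suc k)      ≡⟨ mirror-inside (m<n⇒0<n∸m a<N) (∸-monoʳ-< z<s (<⇒≤ a<N)) ⟩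
    N ∸ (N ∸ suc k)         ≡⟨ m∸[m∸n]≡n (<⇒≤ a<N) ⟩
    suc k                   ∎
    where open ≡-Reasoning

  mirror-injective : ∀ {a b} → a < N → mirror a ≡ mirror b → a ≡ b
  mirror-injective {a} {b} a<N e = begin
    a                 ≡⟨ mirror-involutive a<N ⟨
    mirror (mirror a) ≡⟨ cong mirror e ⟩
    mirror (mirror b) ≡⟨ mirror-involutive (mirror<N⁻¹ (subst (_< N) e (mirror<N a<N))) ⟩
    b                 ∎
    where open ≡-Reasoning

  mirror-antitone : ∀ {a b} → 0 < a → a ≤ b → b < N → mirror b ≤ mirror a
  mirror-antitone 0<a a≤b b<N
    rewrite mirror-inside 0<a (≤-<-trans a≤b b<N) | mirror-inside (<-≤-trans 0<a a≤b) b<N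
    = ∸-monoʳ-≤ N a≤b

  mirror-reverses-< : ∀ {a b} → 0 < a → a < b → b < N → mirror b < mirror a
  mirror-reverses-< 0<a a<b b<N
    rewrite mirror-inside 0<a (<-trans a<b b<N) | mirror-inside (<-trans 0<a a<b) b<N = ∸-monoʳ-< a<b (<⇒≤ b<N)

  private
    mirror-wrap : ∀ {b} → suc b ≡ N → CyclicNeighbours N 0 (mirror b)
    mirror-wrap {zero}  1≡N   = inj₂ (inj₂ (inj₁ (refl , 1≡N)))
    mirror-wrap {suc k} 2+k≡N rewrite mirror-inside z<s (subst (suc k <_) 2+k≡N ≤-refl) =
      inj₁ (trans (cong (_∸ suc k) (sym 2+k≡N)) (m+n∸n≡m 1 (suc k)))

    mirror-suc : ∀ {a} → suc a < N → CyclicNeighbours N (mirror a) (mirror (suc a))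
    mirror-suc {zero}  1<N rewrite mirror-inside z<s 1<N = inj₂ (inj₂ (inj₁ (refl , m+[n∸m]≡n (<⇒≤ 1<N))))
    mirror-suc {suc k} a<N rewrite mirror-inside z<s (<-trans (n<1+n (suc k)) a<N) | mirror-inside z<s a<N =
      inj₂ (inj₁ (+-∸-assoc 1 (<⇒≤ a<N)))

  mirror-neighbours : ∀ {a b} → a < N → b < N
    → CyclicNeighbours N a b → CyclicNeighbours N (mirror a) (mirror b)
  mirror-neighbours _   b<N (inj₁ refl)                   = mirror-suc b<N
  mirror-neighbours a<N _   (inj₂ (inj₁ refl))            = CyclicNeighbours-sym (mirror-suc a<N)
  mirror-neighbours _   _   (inj₂ (inj₂ (inj₁ (refl , e)))) = mirror-wrap e
  mirror-neighbours _   _   (inj₂ (inj₂ (inj₂ (refl , e)))) = CyclicNeighbours-sym (mirror-wrap e)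

-- Repairs

CrossOnly : (G : Graph) (u v : Fin (n G)) → BSubset G → Set
CrossOnly G u v S = Conn G S (u , false) (v , true) × ¬ Conn G S (u , false) (v , false)

StraightOnly : (G : Graph) (u v : Fin (n G)) → BSubset G → Set
StraightOnly G u v S = Conn G S (u , false) (v , false) × ¬ Conn G S (u , false) (v , true)

record Repair (G : Graph) (u v : Fin (n G)) : Set where
  field
    forward backward     : BSubset G → BSubset G
    forward-StraightOnly : ∀ {S} → CrossOnly G u v S → StraightOnly G u v (forward S)
    backward-forward     : ∀ {S} → CrossOnly G u v S → backward (forward S) ≡ S

countSubsets-≤-of-Repair : (G : Graph) (u v : Fin (n G))
  (d₀ : (S : BSubset G) → Dec (Conn G S (u , false) (v , false)))
  (d₁ : (S : BSubset G) → Dec (Conn G S (u , false) (v , true)))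
  → Repair G u v → countSubsets G d₁ ≤ countSubsets G d₀
countSubsets-≤-of-Repair G u v d₀ d₁ repair = countSubsets-≤-of-retraction G d₁ d₀ f g f-connects g∘f≡id
  where
  open Repair repair
  f g : BSubset G → BSubset G
  f S = if does (d₀ S) then S else forward S
  g T = if does (d₁ T) then T else backward T

  f-connects : ∀ S → Conn G S (u , false) (v , true) → Conn G (f S) (u , false) (v , false)
  f-connects S cross with d₀ S
  ... | yes straight = straight
  ... | no  ¬straight = proj₁ (forward-StraightOnly (cross , ¬straight))

  g∘f≡id : ∀ S → Conn G S (u , false) (v , true) → g (f S) ≡ S
  g∘f≡id S cross with d₀ S
  ... | yes _ rewrite dec-true (d₁ S) cross = refl
  ... | no  ¬straight rewrite dec-false (d₁ (forward S)) (proj₂ (forward-StraightOnly (cross , ¬straight))) =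
    backward-forward (cross , ¬straight)

¬Conn-across-of-¬vertical : ∀ {G : Graph} {S : BSubset G}
  → (∀ {x} → InS G (x , false) S → InS G (x , true) S → ⊥)
  → ∀ {a b} → ¬ Conn G S (a , false) (b , true)
¬Conn-across-of-¬vertical {G} {S} noVertical w =
  contradiction (Conn-invariant (λ z → proj₂ z ≡ false) preserved w refl) λ ()
  where
  preserved : OnEdges G S λ z z′ → proj₂ z ≡ false → proj₂ z′ ≡ false
  preserved                  _  (inj₁ (refl , _)) _  refl = refl
  preserved {z′ = _ , false} _  (inj₂ (refl , _)) _  refl = refl
  preserved {z′ = _ , true}  px (inj₂ (refl , _)) py refl = ⊥-elim (noVertical px py)

allBut : ∀ {k} → Fin k → Fin k → Bool
allBut u x = not (does (x Fin.≟ u))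

allBut-self : ∀ {k} (u : Fin k) → allBut u u ≡ false
allBut-self u = cong not (dec-true (u Fin.≟ u) refl)

allBut-other : ∀ {k} {u x : Fin k} → x ≢ u → allBut u x ≡ true
allBut-other {u = u} {x} x≢u = cong not (dec-false (x Fin.≟ u) x≢u)

only : ∀ {k} → Fin k → Fin k → Bool
only v x = does (x Fin.≟ v)

only-self : ∀ {k} (v : Fin k) → only v v ≡ true
only-self v = dec-true (v Fin.≟ v) refl

only-other : ∀ {k} {v x : Fin k} → x ≢ v → only v x ≡ false
only-other {v = v} {x} x≢v = dec-false (x Fin.≟ v) x≢v

-- Every edge avoiding u is compatible with allBut u, so only the edges leaving u⁰ need a bridge.
swap-allBut-bridged : ∀ {G : Graph} {X : BSubset G} {u} → mem X u true ≡ false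
  → (∀ {y} → y ≢ u → Adj G u y → InS G (y , false) X
       → Conn G (swapLayers (allBut u) X) (u , false) (y , true))
  → ∀ {z} → Conn G X (u , false) z → Conn G (swapLayers (allBut u) X) (u , false) (swapVertex (allBut u) z)
swap-allBut-bridged {G} {X} {u} u¹∉X bridge w =
  Conn-layers (allBut-self u) refl (Conn-invariant I preserved w (here (InS-swapVertex R X {u , false} (Conn-head w))))
  where
  R = allBut u
  T = swapLayers R X
  I : BVertex G → Set
  I z = Conn G T (swapVertex R (u , false)) (swapVertex R z)

  layer-at-u : ∀ {b} → InS G (u , b) X → b ≡ false
  layer-at-u {false} _    = refl
  layer-at-u {true}  u¹∈X = contradiction (trans (sym u¹∉X) u¹∈X) λ ()

  preserved : OnEdges G X λ z z′ → I z → I z′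
  preserved p (inj₂ (refl , b≢c)) q walk = Conn-trans walk (swap-edge R X p (inj₂ (refl , b≢c)) q (inj₁ refl))
  preserved {x , b} {y , .b} p (inj₁ (refl , xy)) q walk with toSum (x Fin.≟ u) | toSum (y Fin.≟ u)
  ... | _        | inj₁ refl with layer-at-u q
  ...   | refl = here (InS-swapVertex R X {u , false} q)
  preserved p (inj₁ (refl , uy)) q walk | inj₁ refl | inj₂ y≢u with layer-at-u p
  ...   | refl = Conn-layers (sym (allBut-self u)) (sym (allBut-other y≢u)) (bridge y≢u uy q)
  preserved p e q walk | inj₂ x≢u | inj₂ y≢u =
    Conn-trans walk (swap-edge R X p e q (inj₁ (trans (allBut-other x≢u) (sym (allBut-other y≢u)))))

module CrossOnlyFacts {G : Graph} {u v : Fin (n G)} {S : BSubset G} (src : CrossOnly G u v S) where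

  u⁰∈S : mem S u false ≡ true
  u⁰∈S = Conn-head (proj₁ src)

  v¹∈S : mem S v true ≡ true
  v¹∈S = Conn-last (proj₁ src)

  v⁰∉S : mem S v false ≡ false
  v⁰∉S with mem S v false in v⁰
  ... | false = refl
  ... | true  = contradiction (Conn-trans (proj₁ src) (vertical true false v¹∈S v⁰ λ ())) (proj₂ src)

  u≢v : u ≢ v
  u≢v refl = proj₂ src (here u⁰∈S)

  ≢v : ∀ {x} → mem S x false ≡ true → x ≢ v
  ≢v x⁰∈S refl = contradiction (trans (sym v⁰∉S) x⁰∈S) λ ()

  u¹∉S : ¬ Symmetric S u → mem S u true ≡ false
  u¹∉S asym with mem S u true in u¹
  ... | false = refl
  ... | true  = contradiction u⁰∈S asym

  StraightOnly-swapLayers : ∀ {R} → R v ≡ true → Conn G (swapLayers R S) (u , false) (v , false)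
    → StraightOnly G u v (swapLayers R S)
  StraightOnly-swapLayers {R} Rv straight =
    straight , λ cross → contradiction (InS⇒mem {G} {swapLayers R S} true (Conn-last cross)) v¹∉T
    where
    v¹∉T : mem (swapLayers R S) v true ≢ true
    v¹∉T rewrite mem-swapLayers R S v true | Rv | v⁰∉S = λ ()

  swap-allBut-connects : Symmetric S u → Conn G (swapLayers (allBut u) S) (u , false) (v , false)
  swap-allBut-connects sym-u = Conn-layers (allBut-self u) (cong not (allBut-other (λ v≡u → u≢v (sym v≡u))))
    (swap-walk (allBut u) S compatible (proj₁ src))
    where
    compatible : OnEdges G S λ z z′ → Compatible (allBut u) S (proj₁ z) (proj₁ z′)
    compatible {x , _} {y , _} _ _ _ with toSum (x Fin.≟ u) | toSum (y Fin.≟ u)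
    ... | inj₁ refl | _         = inj₂ (inj₁ sym-u)
    ... | inj₂ _    | inj₁ refl = inj₂ (inj₂ sym-u)
    ... | inj₂ x≢u  | inj₂ y≢u  = inj₁ (trans (allBut-other x≢u) (sym (allBut-other y≢u)))

-- Cycles and paths

record CyclicLayout (G : Graph) (u : Fin (n G)) (N : ℕ) (pos : Fin (n G) → ℕ) (S : BSubset G) : Set where
  field
    pos-u          : pos u ≡ 0
    pos-injective  : ∀ {x y} → pos x < N → pos x ≡ pos y → x ≡ y
    pos-occupied   : ∀ {x b} → InS G (x , b) S → pos x < N
    pos-neighbours : ∀ {x y b} → InS G (x , b) S → InS G (y , b) S → Adj G x y
                     → CyclicNeighbours N (pos x) (pos y)

mirrorLayout : ∀ {G u N pos S} → CyclicLayout G u N pos S → CyclicLayout G u N (mirror N ∘ pos) S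
mirrorLayout {N = N} {pos} L = record
  { pos-u          = cong (mirror N) pos-u
  ; pos-injective  = λ m<N e → pos-injective (mirror<N⁻¹ N m<N) (mirror-injective N (mirror<N⁻¹ N m<N) e)
  ; pos-occupied   = mirror<N N ∘ pos-occupied
  ; pos-neighbours = λ p q xy → mirror-neighbours N (pos-occupied p) (pos-occupied q) (pos-neighbours p q xy)
  }
  where open CyclicLayout L

module OnCycle {G : Graph} {u v : Fin (n G)} {N : ℕ} {pos : Fin (n G) → ℕ} {S : BSubset G}
  (L : CyclicLayout G u N pos S) (src : CrossOnly G u v S) where
  open CyclicLayout L
  open CrossOnlyFacts src

  pos-v<N : pos v < N
  pos-v<N = pos-occupied {b = true} v¹∈S

  0<pos-v : 0 < pos v
  0<pos-v = n≢0⇒n>0 λ pos-v≡0 → u≢v (sym (pos-injective pos-v<N (trans pos-v≡0 (sym pos-u))))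

  pos≡0⇒≡u : ∀ {x} → pos x ≡ 0 → x ≡ u
  pos≡0⇒≡u {x} e = sym (pos-injective (subst (_< N) (sym pos-u) (<-trans 0<pos-v pos-v<N)) (trans pos-u (sym e)))

  pos-injective′ : ∀ {x y} → pos y < N → pos x ≡ pos y → x ≡ y
  pos-injective′ y<N e = sym (pos-injective y<N (sym e))

  beyond-v : ∀ {y} → pos v ≤ pos y → InS G (y , false) S → pos v < pos y
  beyond-v v≤y y⁰∈S = ≤∧≢⇒< v≤y λ e → ≢v y⁰∈S (pos-injective′ pos-v<N (sym e))

  swap-between-StraightOnly : ∀ {w w′} → Symmetric S w → Symmetric S w′
    → pos w < pos v → pos v < pos w′ → pos w′ < N
    → StraightOnly G u v (swapLayers (between (pos w) (pos w′) ∘ pos) S)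
  swap-between-StraightOnly {w} {w′} sym-w sym-w′ w<v v<w′ w′<N =
    StraightOnly-swapLayers {R} Rv (Conn-layers (cong (between (pos w) (pos w′)) pos-u) (cong not Rv)
      (swap-walk R S compatible (proj₁ src)))
    where
    R = between (pos w) (pos w′) ∘ pos

    Rv : R v ≡ true
    Rv rewrite <⇒<ᵇ≡true w<v | <⇒<ᵇ≡true v<w′ = refl

    last-outside : ∀ {k} → suc k ≡ N → between (pos w) (pos w′) k ≡ false
    last-outside {k} 1+k≡N rewrite ≤⇒<ᵇ≡false {k} {pos w′} (≤-pred (subst (pos w′ <_) (sym 1+k≡N) w′<N))
      = Bool.∧-zeroʳ (pos w <ᵇ k)

    boundary : ∀ {x y} → pos y ≡ suc (pos x) → R x ≢ R y → Symmetric S x ⊎ Symmetric S y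
    boundary {x} {y} e Rx≢Ry
      with between-step (pos w) (pos w′) (pos x) (λ R≡ → Rx≢Ry (trans R≡ (cong (between _ (pos w′)) (sym e))))
    ... | inj₁ x≡w  = inj₁ (subst (Symmetric S) (sym (pos-injective′ (<-trans w<v pos-v<N) x≡w)) sym-w)
    ... | inj₂ y≡w′ = inj₂ (subst (Symmetric S) (sym (pos-injective′ w′<N (trans e y≡w′))) sym-w′)

    crossing : ∀ {x y} → CyclicNeighbours N (pos x) (pos y) → R x ≢ R y → Symmetric S x ⊎ Symmetric S y
    crossing (inj₁ e) Rx≢Ry = boundary e Rx≢Ry
    crossing (inj₂ (inj₁ e)) Rx≢Ry = Sum.swap (boundary e (Rx≢Ry ∘ sym))
    crossing {x} {y} (inj₂ (inj₂ (inj₁ (x≡0 , 1+y≡N)))) Rx≢Ry =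
      contradiction (trans (cong (between (pos w) (pos w′)) x≡0) (sym (last-outside 1+y≡N))) Rx≢Ry
    crossing {x} {y} (inj₂ (inj₂ (inj₂ (y≡0 , 1+x≡N)))) Rx≢Ry =
      contradiction (trans (last-outside 1+x≡N) (cong (between (pos w) (pos w′)) (sym y≡0))) Rx≢Ry

    compatible : OnEdges G S λ z z′ → Compatible R S (proj₁ z) (proj₁ z′)
    compatible _ (inj₂ (refl , _)) _ = inj₁ refl
    compatible {x , _} {y , _} p (inj₁ (refl , xy)) q with R x Bool.≟ R y
    ... | yes Rx≡Ry = inj₁ Rx≡Ry
    ... | no  Rx≢Ry = inj₂ (crossing (pos-neighbours p q xy) Rx≢Ry)

  -- Only the edges at u cross the boundary of R without a symmetric endpoint; a walk using them
  -- stays in layer 0 beyond v (nothing there lets it change layers) until it returns to u.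
  swap-above-StraightOnly : ∀ {w} → ¬ Symmetric S u → Symmetric S w → pos w < pos v
    → (∀ {x} → InS G (x , false) S → InS G (x , true) S → pos v < pos x → ⊥)
    → StraightOnly G u v (swapLayers ((pos w <ᵇ_) ∘ pos) S)
  swap-above-StraightOnly {w} u-asym sym-w w<v noVerticalBeyond =
    finish (Conn-invariant I preserved (proj₁ src) (inj₁ (here u⁰∈T)))
    where
    R = (pos w <ᵇ_) ∘ pos
    T = swapLayers R S

    u⁰∈T : InS G (swapVertex R (u , false)) T
    u⁰∈T = InS-swapVertex R S {u , false} u⁰∈S

    I : BVertex G → Set
    I z = Conn G T (swapVertex R (u , false)) (swapVertex R z) ⊎ (proj₂ z ≡ false × pos v < pos (proj₁ z))

    layer-at-u : ∀ {x b} → x ≡ u → InS G (x , b) S → b ≡ false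
    layer-at-u {b = false} _    _    = refl
    layer-at-u {b = true}  refl u¹∈S = contradiction (trans (sym (u¹∉S u-asym)) u¹∈S) λ ()

    back-at-u : ∀ {y b} → y ≡ u → InS G (y , b) S → I (y , b)
    back-at-u y≡u py with layer-at-u y≡u py | y≡u
    ... | refl | refl = inj₁ (here u⁰∈T)

    at-w : ∀ {x} → x ≡ w → Symmetric S x
    at-w refl = sym-w

    w-boundary : ∀ {x y} → pos y ≡ suc (pos x) → R x ≢ R y → x ≡ w
    w-boundary {x} e Rx≢Ry = pos-injective′ (<-trans w<v pos-v<N)
      (<ᵇ-stepʳ (pos w) (pos x) λ R≡ → Rx≢Ry (trans R≡ (cong (pos w <ᵇ_) (sym e))))

    from-beyond : ∀ {x y c} → InS G (x , false) S → BAdj G (x , false) (y , c) → InS G (y , c) S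
      → pos v < pos x → I (y , c)
    from-beyond {c = false} _  (inj₂ (refl , f≢f)) _  _   = contradiction refl f≢f
    from-beyond {c = true}  px (inj₂ (refl , _))   py v<x = ⊥-elim (noVerticalBeyond px py v<x)
    from-beyond px (inj₁ (refl , xy)) py v<x with pos-neighbours {b = false} px py xy
    ... | inj₁ e                       = inj₂ (refl , subst (pos v <_) (sym e) (m≤n⇒m≤1+n v<x))
    ... | inj₂ (inj₁ e)                = inj₂ (refl , beyond-v (≤-pred (subst (pos v <_) e v<x)) py)
    ... | inj₂ (inj₂ (inj₁ (x≡0 , _))) = contradiction (subst (pos v <_) x≡0 v<x) λ ()
    ... | inj₂ (inj₂ (inj₂ (y≡0 , _))) = back-at-u (pos≡0⇒≡u y≡0) py

    extend : ∀ {z z′} → Conn G T (swapVertex R (u , false)) (swapVertex R z)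
      → InS G z S → BAdj G z z′ → InS G z′ S → Compatible R S (proj₁ z) (proj₁ z′) → I z′
    extend walk p e q compatible = inj₁ (Conn-trans walk (swap-edge R S p e q compatible))

    preserved : OnEdges G S λ z z′ → I z → I z′
    preserved px e py (inj₂ (refl , v<x)) = from-beyond px e py v<x
    preserved {x , _} {y , _} px e py (inj₁ walk) with R x Bool.≟ R y
    ... | yes Rx≡Ry = extend walk px e py (inj₁ Rx≡Ry)
    preserved px (inj₂ (refl , _)) py (inj₁ walk) | no Rx≢Ry = contradiction refl Rx≢Ry
    preserved px (inj₁ (refl , xy)) py (inj₁ walk) | no Rx≢Ry with pos-neighbours px py xy
    ... | inj₁ e        = extend walk px (inj₁ (refl , xy)) py (inj₂ (inj₁ (at-w (w-boundary e Rx≢Ry))))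
    ... | inj₂ (inj₁ e) = extend walk px (inj₁ (refl , xy)) py (inj₂ (inj₂ (at-w (w-boundary e (Rx≢Ry ∘ sym)))))
    ... | inj₂ (inj₂ (inj₂ (y≡0 , _)))     = back-at-u (pos≡0⇒≡u y≡0) py
    ... | inj₂ (inj₂ (inj₁ (x≡0 , 1+y≡N))) with layer-at-u (pos≡0⇒≡u x≡0) px
    ...   | refl = inj₂ (refl , beyond-v (≤-pred (subst (pos v <_) (sym 1+y≡N) pos-v<N)) py)

    Rv : R v ≡ true
    Rv = <⇒<ᵇ≡true w<v

    finish : I (v , true) → StraightOnly G u v T
    finish (inj₁ walk) = StraightOnly-swapLayers {R} Rv (Conn-layers (cong (pos w <ᵇ_) pos-u) (cong not Rv) walk)

module _ (G : Graph) (u v : Fin (n G)) (N : ℕ) (pos : Fin (n G) → ℕ) where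

  SymmetricBelow : Vec Bool (n G) → Fin (n G) → Set
  SymmetricBelow Y w = lookup Y w ≡ false × 0 < pos w × pos w < pos v

  SymmetricAbove : Vec Bool (n G) → Fin (n G) → Set
  SymmetricAbove Y w = lookup Y w ≡ false × pos v < pos w × pos w < N

  swapChoice : (Y : Vec Bool (n G)) → Bool → Dec (∃ (SymmetricBelow Y)) → Dec (∃ (SymmetricAbove Y))
    → Fin (n G) → Bool
  swapChoice Y false _               _                = allBut u
  swapChoice Y true  (yes (w , _))   (yes (w′ , _))   = between (pos w) (pos w′) ∘ pos
  swapChoice Y true  (yes (w , _))   (no _)           = (pos w <ᵇ_) ∘ pos
  swapChoice Y true  (no _)          (yes (w′ , _))   = (mirror N (pos w′) <ᵇ_) ∘ mirror N ∘ pos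
  swapChoice Y true  (no _)          (no _)           = allBut u

  cycleSwap : Vec Bool (n G) → Fin (n G) → Bool
  cycleSwap Y = swapChoice Y (lookup Y u)
    (Fin.any? λ w → (lookup Y w Bool.≟ false) ×-dec (0 <? pos w) ×-dec (pos w <? pos v))
    (Fin.any? λ w → (lookup Y w Bool.≟ false) ×-dec (pos v <? pos w) ×-dec (pos w <? N))

  cycleSwap-StraightOnly : ∀ {S} → CyclicLayout G u N pos S → CrossOnly G u v S
    → StraightOnly G u v (swapLayers (cycleSwap (asymmetries S)) S)
  cycleSwap-StraightOnly {S} L src = choose (lookup Y u) refl _ _
    where
    open CyclicLayout L
    open CrossOnlyFacts src
    open OnCycle L src
    Y = asymmetries S

    symmetric : ∀ {x} → lookup Y x ≡ false → Symmetric S x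
    symmetric = asymmetries≡false⇒Symmetric S _

    both-symmetric : ∀ {x} → InS G (x , false) S → InS G (x , true) S → lookup Y x ≡ false
    both-symmetric {x} px py = Symmetric⇒asymmetries≡false S x (trans px (sym py))

    not-below : lookup Y u ≡ true → ¬ ∃ (SymmetricBelow Y)
      → ∀ {x} → InS G (x , false) S → InS G (x , true) S → pos x < pos v → ⊥
    not-below Yu noBelow {x} px py x<v with 0 <? pos x
    ... | yes 0<x = noBelow (_ , both-symmetric px py , 0<x , x<v)
    ... | no  0≮x with pos≡0⇒≡u (n≤0⇒n≡0 (≮⇒≥ 0≮x))
    ...   | refl = asymmetries≡true⇒¬Symmetric S u Yu (trans px (sym py))

    no-vertical-mirrored : lookup Y u ≡ true → ¬ ∃ (SymmetricBelow Y)
      → ∀ {x} → InS G (x , false) S → InS G (x , true) S → mirror N (pos v) < mirror N (pos x) → ⊥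
    no-vertical-mirrored Yu noBelow {x} px py mv<mx with pos x <? pos v
    ... | yes x<v = not-below Yu noBelow px py x<v
    ... | no  x≮v = <⇒≱ mv<mx (mirror-antitone N 0<pos-v (≮⇒≥ x≮v) (pos-occupied {b = false} px))

    choose : ∀ a → lookup Y u ≡ a → ∀ below above
      → StraightOnly G u v (swapLayers (swapChoice Y a below above) S)
    choose false Yu _ _ = StraightOnly-swapLayers {R = allBut u} (allBut-other (u≢v ∘ sym))
                            (swap-allBut-connects (symmetric Yu))
    choose true Yu (yes (w , Yw , _ , w<v)) (yes (w′ , Yw′ , v<w′ , w′<N)) =
      swap-between-StraightOnly (symmetric Yw) (symmetric Yw′) w<v v<w′ w′<N
    choose true Yu (yes (w , Yw , _ , w<v)) (no noAbove) =
      swap-above-StraightOnly (asymmetries≡true⇒¬Symmetric S u Yu) (symmetric Yw) w<v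
        λ px py v<x → noAbove (_ , both-symmetric px py , v<x , pos-occupied {b = false} px)
    -- Reflecting the positions puts the symmetric vertex above v below it.
    choose true Yu (no noBelow) (yes (w′ , Yw′ , v<w′ , w′<N)) =
      OnCycle.swap-above-StraightOnly (mirrorLayout L) src (asymmetries≡true⇒¬Symmetric S u Yu) (symmetric Yw′)
        (mirror-reverses-< N 0<pos-v v<w′ w′<N) (no-vertical-mirrored Yu noBelow)
    choose true Yu (no noBelow) (no noAbove) = ⊥-elim (¬Conn-across-of-¬vertical {S = S} no-vertical (proj₁ src))
      where
      no-vertical : ∀ {x} → InS G (x , false) S → InS G (x , true) S → ⊥
      no-vertical {x} px py with <-cmp (pos x) (pos v)
      ... | tri< x<v _ _ = not-below Yu noBelow px py x<v
      ... | tri≈ _ x≡v _ = ≢v px (pos-injective′ pos-v<N x≡v)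
      ... | tri> _ _ v<x = noAbove (_ , both-symmetric px py , v<x , pos-occupied {b = false} px)

  cycleRepair : (∀ {S} → CrossOnly G u v S → CyclicLayout G u N pos S) → Repair G u v
  cycleRepair layout = record
    { forward              = swapByAsymmetries cycleSwap
    ; backward             = swapByAsymmetries cycleSwap
    ; forward-StraightOnly = λ src → cycleSwap-StraightOnly (layout src) src
    ; backward-forward     = λ {S} _ → swapByAsymmetries-involutive cycleSwap S
    }

offsetLayout : (G : Graph) → (∀ {x y} → Adj G x y → CycleAdj (n G) x y) → (u : Fin (n G))
  → ∀ {S} → CyclicLayout G u (n G) (offset u) S
offsetLayout G adj u = record
  { pos-u          = offset-self u
  ; pos-injective  = λ _ → offset-injective u
  ; pos-occupied   = λ {x} _ → offset<N u x
  ; pos-neighbours = λ _ _ xy → offset-neighbours u (adj xy)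
  }

-- Wheels

hub : ∀ {m} → Fin (suc m)
hub = fz

via-hub : ∀ {m} {T : BSubset (wheelGraph m)} c {x y}
  → InS (wheelGraph m) (x , c) T → InS (wheelGraph m) (hub , c) T → InS (wheelGraph m) (y , c) T
  → Conn (wheelGraph m) T (x , c) (y , c)
via-hub c {fz}   {fz}   px _  _  = here px
via-hub c {fz}   {fs _} px _  py = horizontal c px py tt
via-hub c {fs _} {fz}   px _  py = horizontal c px py tt
via-hub c {fs _} {fs _} px ph py = Conn-trans (horizontal c px ph tt) (horizontal c ph py tt)

-- The hub gets position m, outside the rim positions 0 … m-1 (as does everything if u is the hub,
-- a case in which no layout is needed).
rimOffset : (m : ℕ) → Fin (suc m) → Fin (suc m) → ℕ
rimOffset m (fs u′) (fs x) = offset u′ x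
rimOffset m _       _      = m

wheelLayout : ∀ {m u} {S : BSubset (wheelGraph m)} → occupied S hub ≡ false → mem S u false ≡ true
  → CyclicLayout (wheelGraph m) u m (rimOffset m u) S
wheelLayout {u = fz} {S} hub-absent u⁰∈S =
  contradiction (trans (sym (unoccupied {S = S} false hub-absent)) u⁰∈S) λ ()
wheelLayout {m} {fs u′} {S} hub-absent _ = record
  { pos-u          = offset-self u′
  ; pos-injective  = injective
  ; pos-occupied   = on-rim
  ; pos-neighbours = neighbours
  }
  where
  G = wheelGraph m
  pos = rimOffset m (fs u′)

  hub∉S : ∀ {b} → ¬ InS G (hub , b) S
  hub∉S {b} p = contradiction (trans (sym (unoccupied {S = S} b hub-absent)) (InS⇒mem {G} {S} b p)) λ ()

  injective : ∀ {x y} → pos x < m → pos x ≡ pos y → x ≡ y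
  injective {fz}          m<m _ = contradiction refl (<⇒≢ m<m)
  injective {fs x} {fz}   _   e = contradiction e (<⇒≢ (offset<N u′ x))
  injective {fs x} {fs y} _   e = cong fs (offset-injective u′ e)

  on-rim : ∀ {x b} → InS G (x , b) S → pos x < m
  on-rim {fz}   p = ⊥-elim (hub∉S p)
  on-rim {fs x} _ = offset<N u′ x

  neighbours : ∀ {x y b} → InS G (x , b) S → InS G (y , b) S → Adj G x y → CyclicNeighbours m (pos x) (pos y)
  neighbours {fz}          p _ _  = ⊥-elim (hub∉S p)
  neighbours {fs _} {fz}   _ q _  = ⊥-elim (hub∉S q)
  neighbours {fs _} {fs _} _ _ xy = offset-neighbours u′ xy

module _ (m : ℕ) (u v : Fin (suc m))
  (d₀ : (S : BSubset (wheelGraph m)) → Dec (Conn (wheelGraph m) S (u , false) (v , false)))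
  (d₁ : (S : BSubset (wheelGraph m)) → Dec (Conn (wheelGraph m) S (u , false) (v , true))) where

  private
    G = wheelGraph m
    rimSwap = cycleSwap G u v m (rimOffset m u)

  swapAllBut swapOnly : BSubset G → BSubset G
  swapAllBut = swapLayers (allBut u)
  swapOnly   = swapLayers (only v)

  -- The arguments are: is the hub occupied, is u asymmetric, is hub⁰ in the set.
  forwardBy backwardBy : Bool → Bool → Bool → BSubset G → BSubset G
  forwardBy false _     _     = swapByAsymmetries rimSwap
  forwardBy true  false _     = swapAllBut
  forwardBy true  true  true  = swapOnly
  forwardBy true  true  false = λ S → if does (d₀ (swapOnly S)) then swapOnly S else swapAllBut S
  backwardBy false _     _     = swapByAsymmetries rimSwap
  backwardBy true  false _     = swapAllBut
  backwardBy true  true  false = swapOnly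
  -- T = swapAllBut S is told apart from T = swapOnly S by swapOnly-swapAllBut-¬cross.
  backwardBy true  true  true  = λ T → if does (d₁ (swapOnly T)) then swapOnly T else swapAllBut T

  wheelForward wheelBackward : BSubset G → BSubset G
  wheelForward  S = forwardBy  (occupied S hub) (lookup (asymmetries S) u) (mem S hub false) S
  wheelBackward T = backwardBy (occupied T hub) (lookup (asymmetries T) u) (mem T hub false) T

  wheelBackward-swapLayers : ∀ R S {a c h} → occupied S hub ≡ a → lookup (asymmetries S) u ≡ c
    → mem (swapLayers R S) hub false ≡ h → wheelBackward (swapLayers R S) ≡ backwardBy a c h (swapLayers R S)
  wheelBackward-swapLayers R S refl refl refl
    rewrite occupied-swapLayers R S hub | cong (λ Y → lookup Y u) (asymmetries-swapLayers R S) = refl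

  module _ {S : BSubset G} (src : CrossOnly G u v S) where
    open CrossOnlyFacts src

    InS-swapOnly : ∀ {x} c → x ≢ v → mem S x c ≡ true → InS G (x , c) (swapOnly S)
    InS-swapOnly {x} c x≢v p =
      mem⇒InS {G} {swapOnly S} c (trans (mem-swapLayers-fixed (only v) S x c (only-other x≢v)) p)

    u⁰∈swapOnly : InS G (u , false) (swapOnly S)
    u⁰∈swapOnly = InS-swapOnly false u≢v u⁰∈S

    v⁰∈swapOnly : InS G (v , false) (swapOnly S)
    v⁰∈swapOnly = trans (mem-swapLayers-moved (only v) S v false (only-self v)) v¹∈S

    hub¹∈S : occupied S hub ≡ true → mem S hub false ≡ false → mem S hub true ≡ true
    hub¹∈S occ hub⁰∉S = trans (sym (cong (_∨ mem S hub true) hub⁰∉S)) occ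

    -- The walk to v¹ changes layers at some rim vertex, whose upper copy is adjacent to hub¹.
    hub¹-reachable : mem S hub false ≡ false → mem S hub true ≡ true → hub ≢ v
      → Conn G (swapOnly S) (u , false) (hub , true)
    hub¹-reachable hub⁰∉S hub¹∈S hub≢v =
      finish (Conn-invariant I preserved (proj₁ src) (inj₁ (refl , here u⁰∈swapOnly)))
      where
      I : BVertex G → Set
      I z = (proj₂ z ≡ false × Conn G (swapOnly S) (u , false) z) ⊎ Conn G (swapOnly S) (u , false) (hub , true)

      preserved : OnEdges G S λ z z′ → I z → I z′
      preserved _ _ _ (inj₂ reached) = inj₂ reached
      preserved _ (inj₁ (refl , xy)) q (inj₁ (refl , walk)) =
        inj₁ (refl , Conn-trans walk (horizontal false (Conn-last walk) (InS-swapOnly false (≢v q) q) xy))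
      preserved {_ , false} {_ , false} _ (inj₂ (refl , f≢f)) _ _ = contradiction refl f≢f
      preserved {fz , false} {_ , true} p (inj₂ (refl , _)) _ _ = contradiction (trans (sym hub⁰∉S) p) λ ()
      preserved {fs _ , false} {_ , true} p (inj₂ (refl , _)) q (inj₁ (refl , walk)) =
        inj₂ (Conn-trans walk
               (Conn-trans (vertical false true (Conn-last walk) x¹ λ ()) (horizontal true x¹ hub¹ tt)))
        where
        x¹ = InS-swapOnly true (≢v p) q
        hub¹ = InS-swapOnly true hub≢v hub¹∈S

      finish : I (v , true) → Conn G (swapOnly S) (u , false) (hub , true)
      finish (inj₂ reached) = reached

    -- Swapping everything but u in swapOnly (swapAllBut S) gives back swapOnly S, where the edges at u
    -- are bridged through hub¹; so a walk from u⁰ to v¹ would become one from u⁰ to v⁰ in swapOnly S.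
    swapOnly-swapAllBut-¬cross : ¬ Symmetric S u → mem S hub false ≡ false → mem S hub true ≡ true → hub ≢ v
      → ¬ Conn G (swapOnly S) (u , false) (v , false) → ¬ Conn G (swapOnly (swapAllBut S)) (u , false) (v , true)
    swapOnly-swapAllBut-¬cross u-asym hub⁰∉S hub¹∈S hub≢v ¬straight cross =
      ¬straight (subst (λ Z → Conn G Z (u , false) (v , false)) swapAllBut-X
        (Conn-layers refl (cong (true xor_) (allBut-other (u≢v ∘ sym))) (swap-allBut-bridged u¹∉X bridge cross)))
      where
      X = swapOnly (swapAllBut S)

      swapAllBut-X : swapAllBut X ≡ swapOnly S
      swapAllBut-X =
        trans (swapLayers-comm (allBut u) (only v) (swapAllBut S)) (cong swapOnly (swapLayers-involutive (allBut u) S))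

      u¹∉X : mem X u true ≡ false
      u¹∉X = trans (mem-swapLayers-fixed (only v) (swapAllBut S) u true (only-other u≢v))
               (trans (mem-swapLayers-fixed (allBut u) S u true (allBut-self u)) (u¹∉S u-asym))

      bridge : ∀ {y} → y ≢ u → Adj G u y → InS G (y , false) X → Conn G (swapAllBut X) (u , false) (y , true)
      bridge {y} y≢u _ y⁰∈X = subst (λ Z → Conn G Z (u , false) (y , true)) (sym swapAllBut-X)
        (Conn-trans (hub¹-reachable hub⁰∉S hub¹∈S hub≢v) (via-hub true hub¹ hub¹ y¹))
        where
        hub¹ = InS-swapOnly true hub≢v hub¹∈S
        y¹ : InS G (y , true) (swapOnly S)
        y¹ = subst (InS G (y , true)) swapAllBut-X
               (trans (mem-swapLayers-moved (allBut u) X y true (allBut-other y≢u)) y⁰∈X)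

    backwardBy-swapOnly : backwardBy true true true (swapOnly S) ≡ S
    backwardBy-swapOnly rewrite swapLayers-involutive (only v) S | dec-true (d₁ S) (proj₁ src) = refl

    forward-hub⁰∉S : occupied S hub ≡ true → lookup (asymmetries S) u ≡ true → mem S hub false ≡ false
      → (straight? : Dec (Conn G (swapOnly S) (u , false) (v , false)))
      → let T = if does straight? then swapOnly S else swapAllBut S in StraightOnly G u v T × wheelBackward T ≡ S
    forward-hub⁰∉S occ asym hub⁰∉S (yes straight) =
      StraightOnly-swapLayers {R = only v} (only-self v) straight , back (toSum (hub Fin.≟ v))
      where
      back : hub ≡ v ⊎ hub ≢ v → wheelBackward (swapOnly S) ≡ S
      back (inj₁ refl) = trans (wheelBackward-swapLayers (only v) S occ asym
        (trans (mem-swapLayers-moved (only v) S hub false (only-self v)) (hub¹∈S occ hub⁰∉S))) backwardBy-swapOnly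
      back (inj₂ hub≢v) = trans (wheelBackward-swapLayers (only v) S occ asym
        (trans (mem-swapLayers-fixed (only v) S hub false (only-other hub≢v)) hub⁰∉S)) (swapLayers-involutive (only v) S)
    forward-hub⁰∉S occ asym hub⁰∉S (no ¬straight) =
      StraightOnly-swapLayers {R = allBut u} (allBut-other (u≢v ∘ sym)) (via-hub false u⁰∈T hub⁰∈T v⁰∈T) ,
      trans (wheelBackward-swapLayers (allBut u) S occ asym hub⁰∈T) back
      where
      T = swapAllBut S
      u≢hub : u ≢ hub
      u≢hub refl = contradiction (trans (sym hub⁰∉S) u⁰∈S) λ ()
      hub≢v : hub ≢ v
      hub≢v refl = ¬straight (via-hub false u⁰∈swapOnly v⁰∈swapOnly v⁰∈swapOnly)
      u⁰∈T : InS G (u , false) T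
      u⁰∈T = trans (mem-swapLayers-fixed (allBut u) S u false (allBut-self u)) u⁰∈S
      hub⁰∈T : InS G (hub , false) T
      hub⁰∈T = trans (mem-swapLayers-moved (allBut u) S hub false (allBut-other (u≢hub ∘ sym))) (hub¹∈S occ hub⁰∉S)
      v⁰∈T : InS G (v , false) T
      v⁰∈T = trans (mem-swapLayers-moved (allBut u) S v false (allBut-other (u≢v ∘ sym))) v¹∈S
      ¬cross : ¬ Conn G (swapOnly T) (u , false) (v , true)
      ¬cross = swapOnly-swapAllBut-¬cross (asymmetries≡true⇒¬Symmetric S u asym) hub⁰∉S (hub¹∈S occ hub⁰∉S)
                 hub≢v ¬straight
      back : backwardBy true true true T ≡ S
      back rewrite dec-false (d₁ (swapOnly T)) ¬cross = swapLayers-involutive (allBut u) S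

    forwardBy-repairs : ∀ a c h → occupied S hub ≡ a → lookup (asymmetries S) u ≡ c → mem S hub false ≡ h
      → StraightOnly G u v (forwardBy a c h S) × wheelBackward (forwardBy a c h S) ≡ S
    forwardBy-repairs false _ _ hub-absent asym _ =
      cycleSwap-StraightOnly G u v m (rimOffset m u) (wheelLayout hub-absent u⁰∈S) src ,
      trans (wheelBackward-swapLayers (rimSwap (asymmetries S)) S hub-absent asym refl)
            (swapByAsymmetries-involutive rimSwap S)
    forwardBy-repairs true false _ occ asym _ =
      StraightOnly-swapLayers {R = allBut u} (allBut-other (u≢v ∘ sym))
        (swap-allBut-connects (asymmetries≡false⇒Symmetric S u asym)) ,
      trans (wheelBackward-swapLayers (allBut u) S occ asym refl) (swapLayers-involutive (allBut u) S)
    forwardBy-repairs true true true occ asym hub⁰∈S =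
      StraightOnly-swapLayers {R = only v} (only-self v) (via-hub false u⁰∈swapOnly hub⁰∈swapOnly v⁰∈swapOnly) ,
      trans (wheelBackward-swapLayers (only v) S occ asym hub⁰∈swapOnly) backwardBy-swapOnly
      where
      hub⁰∈swapOnly : InS G (hub , false) (swapOnly S)
      hub⁰∈swapOnly = InS-swapOnly false (≢v hub⁰∈S) hub⁰∈S
    forwardBy-repairs true true false occ asym hub⁰∉S = forward-hub⁰∉S occ asym hub⁰∉S (d₀ (swapOnly S))

  wheelRepair : Repair G u v
  wheelRepair = record
    { forward              = wheelForward
    ; backward             = wheelBackward
    ; forward-StraightOnly = λ {S} src → proj₁ (forwardBy-repairs src (occupied S hub) _ _ refl refl refl)
    ; backward-forward     = λ {S} src → proj₂ (forwardBy-repairs src (occupied S hub) _ _ refl refl refl)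
    }

theorem1p2 : (G : Graph) → PathCycleOrWheel G → (u v : Fin (n G))
    → (d₀ : (S : BSubset G) → Dec (Conn G S (u , false) (v , false)))
    → (d₁ : (S : BSubset G) → Dec (Conn G S (u , false) (v , true)))
    → countSubsets G d₁ ≤ countSubsets G d₀
theorem1p2 G G-shape u v d₀ d₁ = countSubsets-≤-of-Repair G u v d₀ d₁ (repair G-shape)
  where
  repair : PathCycleOrWheel G → Repair G u v
  repair (isPath k)    = cycleRepair G u v k (offset u) λ _ → offsetLayout G inj₁ u
  repair (isCycle k _) = cycleRepair G u v k (offset u) λ _ → offsetLayout G id u
  repair (isWheel k _) = wheelRepair k u v d₀ d₁
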